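{- Let $(S,\{\to_e,\to_{\neg e}\})$ be an essential system, with $\to\;=\;\to_e\cup\to_{\neg e}$. If $t\to^* u$ and $u$ is $\to_e$-normal, then $t$ is strongly $\to_e$-normalizing.
   Context: A rewriting system is a pair $(S,\to)$ with $S$ a set and $\to\subseteq S\times S$. We write $(S,\{\to_e,\to_{\neg e}\})$ for the rewriting system $(S,\to)$ with $\to\;=\;\to_e\cup\to_{\neg e}$ (not necessarily disjoint). $\to^*$ is the reflexive-transitive closure; $t\to_a\cdot\to_b s$ means $t\to_a u\to_b s$ for some $u$. A term $t$ is $\to$-normal if there is no $s$ with $t\to s$; weakly $\to$-normalizing if $t\to^* s$ for some $\to$-normal $s$; strongly $\to$-normalizing if there is no infinite $\to$-sequence from $t$. The system is essential if: (1) Persistence: if $t\to_e s$ and $t\to_{\neg e}u$ then $u\to_e r$ for some $r$; (2) Uniform termination: every weakly $\to_e$-normalizing term is strongly $\to_e$-normalizing; (3) Terminal factorization: if $t\to^* u$ and $u$ is $\to_e$-normal then $t\to_e^*\cdot\to_{\neg e}^* u$. -}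

module Defs where

open import Level using (Level; _⊔_; suc)
open import Data.Nat using (ℕ; zero) renaming (suc to sucℕ)
open import Data.Product using (Σ; ∃; _×_; _,_)
open import Data.Sum using (_⊎_)
open import Data.Empty using (⊥)
open import Relation.Nullary using (¬_)
open import Relation.Binary.PropositionalEquality using (_≡_)
open import Relation.Binary.Construct.Closure.ReflexiveTransitive using (Star)

Rel : ∀ {a} → Set a → (ℓ : Level) → Set (a ⊔ suc ℓ)
Rel S ℓ = S → S → Set ℓ

_∪_ : ∀ {a ℓ} {S : Set a} → Rel S ℓ → Rel S ℓ → Rel S ℓ
(R ∪ Q) x y = R x y ⊎ Q x y

_* : ∀ {a ℓ} {S : Set a} → Rel S ℓ → Rel S (a ⊔ ℓ)
R * = Star R

_·_ : ∀ {a ℓ} {S : Set a} → Rel S ℓ → Rel S ℓ → Rel S (a ⊔ ℓ)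
(R · Q) t s = ∃ λ u → R t u × Q u s

Normal : ∀ {a ℓ} {S : Set a} → Rel S ℓ → S → Set (a ⊔ ℓ)
Normal R t = ∀ s → ¬ R t s

WeaklyNormalizing : ∀ {a ℓ} {S : Set a} → Rel S ℓ → S → Set (a ⊔ ℓ)
WeaklyNormalizing R t = ∃ λ s → (R *) t s × Normal R s

StronglyNormalizing : ∀ {a ℓ} {S : Set a} → Rel S ℓ → S → Set (a ⊔ ℓ)
StronglyNormalizing {S = S} R t =
  ¬ (Σ (ℕ → S) λ f → f zero ≡ t × (∀ i → R (f i) (f (sucℕ i))))

record Essential {a ℓ} {S : Set a} (Re Rne : Rel S ℓ) : Set (a ⊔ ℓ) where
  field
    persistence : ∀ {t s u} → Re t s → Rne t u → ∃ λ r → Re u r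
    uniformTermination : ∀ t → WeaklyNormalizing Re t → StronglyNormalizing Re t
    terminalFactorization : ∀ {t u} → ((Re ∪ Rne) *) t u → Normal Re u →
                            ((Re *) · (Rne *)) t u

-- Let t →* u with u →e-normal.  Terminal factorization splits the
-- mixed reduction as t →e* v →¬e* u.  Persistence says that an →e-redex
-- survives every →¬e-step; read contrapositively, →e-normality is
-- reflected backwards along →¬e-steps, hence along →¬e*, so v is
-- →e-normal.  Thus t is weakly →e-normalizing (witnessed by v), and
-- uniform termination upgrades this to strong →e-normalization.
module Submission where

open import Level using (_⊔_)
open import Defs
open import Data.Product using (∃; _,_)
open import Relation.Binary.Construct.Closure.ReflexiveTransitive using (Star; ε; _◅_)

Persistent : ∀ {a ℓ} {S : Set a} → Rel S ℓ → Rel S ℓ → Set (a ⊔ ℓ)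
Persistent R Q = ∀ {t s u} → R t s → Q t u → ∃ λ r → R u r

-- Under persistence, R-normality propagates backwards along Q*:
-- an R-step from the source would persist to an R-step from the target.
normal-reflected : ∀ {a ℓ} {S : Set a} (R Q : Rel S ℓ) → Persistent R Q →
  ∀ {v u} → Star Q v u → Normal R u → Normal R v
normal-reflected R Q persist ε u-normal = u-normal
normal-reflected R Q persist (v→w ◅ w→*u) u-normal s v→s
  with persist v→s v→w
... | (r , w→r) = normal-reflected R Q persist w→*u u-normal r w→r

weakly-normalizing : ∀ {a ℓ} {S : Set a} (Re Rne : Rel S ℓ) →
  Essential Re Rne → ∀ {t u} → ((Re ∪ Rne) *) t u → Normal Re u →
  WeaklyNormalizing Re t
weakly-normalizing Re Rne E t→*u u-normal
  with Essential.terminalFactorization E t→*u u-normal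
... | (v , t→e*v , v→¬e*u) =
  v , t→e*v , normal-reflected Re Rne (Essential.persistence E) v→¬e*u u-normal

theorem2 : ∀ {a ℓ} {S : Set a} (Re Rne : Rel S ℓ) → Essential Re Rne →
    ∀ {t u} → ((Re ∪ Rne) *) t u → Normal Re u → StronglyNormalizing Re t
theorem2 Re Rne E {t} t→*u u-normal =
  Essential.uniformTermination E t (weakly-normalizing Re Rne E t→*u u-normal)
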